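{- Let $q=p^m$, $p$ prime, let $T:\mathbb{F}_q^3\to\mathbb{F}_q$ and $\theta:\mathbb{F}_q^3\to\mathrm{Aut}(\mathbb{F}_q)$ be functions such that $G=\{\mathfrak{g}_{a,b,c}\}$ (notation below) is closed under $\circ$. Then $r_{A,B}=\max\{r_A,r_B\}$, and $G$ is not contained in $\mathrm{PGL}(4,q)$ (i.e. some $\theta_{a,b,c}$ is nontrivial) if and only if $r_{A,B}>0$ or $r_C>0$.
   Context: For $a,b,c,t\in\mathbb{F}_q$ let $E(a,b,c,t)$ be the $4\times4$ matrix with rows $(1,0,0,0)$, $(-c,1,0,0)$, $(b-ct,t,1,0)$, $(a,b,c,1)$. Write $\theta_{a,b,c}=\theta(a,b,c)$ and $\mathfrak{g}_{a,b,c}=(E(a,b,c,T(a,b,c)),\theta_{a,b,c})$, with the product $(A_1,\sigma_1)\circ(A_2,\sigma_2)=(A_1^{\sigma_2}A_2,\sigma_1\sigma_2)$ ($A^\sigma$ applies $\sigma$ entrywise); $G=\{\mathfrak{g}_{a,b,c}: a,b,c\in\mathbb{F}_q\}$. Let $\psi:G\to\mathrm{Aut}(\mathbb{F}_q)$, $\mathfrak{g}_{a,b,c}\mapsto\theta_{a,b,c}$. Let $G_A=\{\mathfrak{g}_{a,0,0}\}$, $G_B=\{\mathfrak{g}_{0,b,0}\}$, $G_{A,B}=\{\mathfrak{g}_{a,b,0}\}$, and let $p^{r_A},p^{r_B},p^{r_{A,B}}$ be the exponents of $\psi(G_A),\psi(G_B),\psi(G_{A,B})$. Put $\sigma_c=\theta_{0,0,c}$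 and let $p^{r_C}=\max\{o(\sigma_c):c\in\mathbb{F}_q\}$. -}

module Defs where

open import Level using (0ℓ)
open import Data.Nat as ℕ using (ℕ; zero; suc; _^_; _<_; _≤_)
open import Data.Nat.Primality using (Prime)
open import Data.Fin using (Fin; zero; suc)
open import Data.Product using (Σ; ∃; _×_; _,_)
open import Function using (_∘_)
open import Function.Bundles using (_↔_)
open import Relation.Nullary using (¬_)
open import Relation.Binary.PropositionalEquality using (_≡_)
open import Algebra.Structures using (IsCommutativeRing)

record FiniteField (p m : ℕ) : Set₁ where
  field
    Carrier : Set
    _+_ _*_ : Carrier → Carrier → Carrier
    -_      : Carrier → Carrier
    0# 1#   : Carrier
    isCommutativeRing : IsCommutativeRing _≡_ _+_ _*_ -_ 0# 1#
    0≢1     : ¬ (0# ≡ 1#)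
    inverse : ∀ x → ¬ (x ≡ 0#) → Σ Carrier λ y → x * y ≡ 1#
    card    : Fin (p ^ m) ↔ Carrier

  infixl 6 _+_ _-_
  infixl 7 _*_

  _-_ : Carrier → Carrier → Carrier
  x - y = x + (- y)

module _ {p m : ℕ} (𝔽 : FiniteField p m) where
  open FiniteField 𝔽

  record Aut : Set where
    field
      fun       : Carrier → Carrier
      bijective : Carrier ↔ Carrier
      fun≗      : ∀ x → Function.Bundles.Inverse.to bijective x ≡ fun x
      pres-+    : ∀ x y → fun (x + y) ≡ fun x + fun y
      pres-*    : ∀ x y → fun (x * y) ≡ fun x * fun y
      pres-1    : fun 1# ≡ 1#
  open Aut public

  _≈ᴬ_ : Aut → Aut → Set
  σ ≈ᴬ τ = ∀ x → fun σ x ≡ fun τ x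

  IsTrivial : Aut → Set
  IsTrivial σ = ∀ x → fun σ x ≡ x

  pow : Aut → ℕ → Carrier → Carrier
  pow σ zero    x = x
  pow σ (suc n) x = fun σ (pow σ n x)

  PowTrivial : Aut → ℕ → Set
  PowTrivial σ n = ∀ x → pow σ n x ≡ x

  HasOrder : Aut → ℕ → Set
  HasOrder σ n = 0 < n × PowTrivial σ n × (∀ k → 0 < k → PowTrivial σ k → n ≤ k)

  HasExponent : {I : Set} → (I → Aut) → ℕ → Set
  HasExponent f n =
    0 < n × (∀ i → PowTrivial (f i) n) ×
    (∀ k → 0 < k → (∀ i → PowTrivial (f i) k) → n ≤ k)

  HasMaxOrder : {I : Set} → (I → Aut) → ℕ → Set
  HasMaxOrder f n =
    (∃ λ i → HasOrder (f i) n) × (∀ i k → HasOrder (f i) k → k ≤ n)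

  Mat : Set
  Mat = Fin 4 → Fin 4 → Carrier

  _⊗_ : Mat → Mat → Mat
  (A ⊗ B) i j = A i zero * B zero j + A i (suc zero) * B (suc zero) j
              + A i (suc (suc zero)) * B (suc (suc zero)) j
              + A i (suc (suc (suc zero))) * B (suc (suc (suc zero))) j

  _^ᴬ_ : Mat → Aut → Mat
  (A ^ᴬ σ) i j = fun σ (A i j)

  _≈ᴹ_ : Mat → Mat → Set
  A ≈ᴹ B = ∀ i j → A i j ≡ B i j

  E : Carrier → Carrier → Carrier → Carrier → Mat
  E a b c t zero zero = 1#
  E a b c t zero (suc _) = 0#
  E a b c t (suc zero) zero = - c
  E a b c t (suc zero) (suc zero) = 1#
  E a b c t (suc zero) (suc (suc _)) = 0#
  E a b c t (suc (suc zero)) zero = b - c * t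
  E a b c t (suc (suc zero)) (suc zero) = t
  E a b c t (suc (suc zero)) (suc (suc zero)) = 1#
  E a b c t (suc (suc zero)) (suc (suc (suc zero))) = 0#
  E a b c t (suc (suc (suc zero))) zero = a
  E a b c t (suc (suc (suc zero))) (suc zero) = b
  E a b c t (suc (suc (suc zero))) (suc (suc zero)) = c
  E a b c t (suc (suc (suc zero))) (suc (suc (suc zero))) = 1#

  SL : Set
  SL = Mat × Aut

  _≈ˢ_ : SL → SL → Set
  (A , σ) ≈ˢ (B , τ) = A ≈ᴹ B × σ ≈ᴬ τ

  ProdIs : SL → SL → SL → Set
  ProdIs (A₁ , σ₁) (A₂ , σ₂) (B , τ) =
    ((A₁ ^ᴬ σ₂) ⊗ A₂) ≈ᴹ B × (∀ x → fun σ₁ (fun σ₂ x) ≡ fun τ x)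

  module _ (T : Carrier → Carrier → Carrier → Carrier)
           (θ : Carrier → Carrier → Carrier → Aut) where

    𝔤 : Carrier → Carrier → Carrier → SL
    𝔤 a b c = E a b c (T a b c) , θ a b c

    Closed : Set
    Closed = ∀ a b c a' b' c' → ∃ λ a'' → ∃ λ b'' → ∃ λ c'' →
               ProdIs (𝔤 a b c) (𝔤 a' b' c') (𝔤 a'' b'' c'')

    -- ψ restricted to G_A, G_B, G_{A,B}, and σ_c
    ψA : Carrier → Aut
    ψA a = θ a 0# 0#
    ψB : Carrier → Aut
    ψB b = θ 0# b 0#
    ψAB : Carrier × Carrier → Aut
    ψAB (a , b) = θ a b 0#
    σC : Carrier → Aut
    σC c = θ 0# 0# c

-- Aut(𝔽_q) is abelian: if x ≠ 0 has multiplicative order n, then 1, x, …, xⁿ⁻¹ are all the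
-- roots of tⁿ − 1, so automorphisms σ and τ send x to powers xⁱ and xʲ, and σ τ x = x^(ij) = τ σ x.
-- Reading off the bottom row of product matrices, closure of G splits
-- θ(a,b,0) = θ(a′,0,0) ∘ θ(0,b,0) and θ(a,b,c) = θ(a″,b″,0) ∘ θ(0,0,c).
-- By commutativity the first splitting makes p^max(r_A, r_B) an exponent of ψ(G_{A,B}), which
-- contains ψ(G_A) and ψ(G_B); the second shows that θ is trivial as soon as ψ(G_{A,B}) and all
-- the σ_c are.

module Submission where

open import Level using (0ℓ)
open import Defs
open import Data.Nat using (ℕ; zero; suc; _<_; _≤_; _⊔_; z≤n; s≤s)
import Data.Nat as ℕ
import Data.Nat.Properties as ℕ
open import Data.Nat.Divisibility using (_∣_; divides; m∣m*n; n∣m*n)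
open import Data.Nat.Primality using (Prime; prime⇒nonZero; prime⇒nonTrivial)
open import Data.Fin using (Fin; zero; suc; toℕ; #_)
import Data.Fin.Properties as Fin
open import Data.List using (List; []; _∷_; length; replicate)
open import Data.List.Properties using (length-replicate)
open import Data.Product using (∃; ∃₂; _×_; _,_; proj₁; proj₂)
open import Data.Sum using (_⊎_; inj₁; inj₂; [_,_]′)
open import Function using (_∘_)
open import Function.Bundles using (Inverse; Injection)
open import Function.Definitions using (Injective)
open import Function.Properties.Inverse using (↔⇒↣; ↔-sym)
open import Relation.Nullary using (¬_; Dec; yes; no; contradiction)
open import Relation.Nullary.Decidable using (map′)
open import Relation.Unary using (Decidable)
open import Relation.Binary.Definitions using (DecidableEquality; tri<; tri≈; tri>)
open import Relation.Binary.PropositionalEquality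
open import Algebra.Bundles using (CommutativeRing)
open import Algebra.Structures using (IsCommutativeRing)

Least : (ℕ → Set) → ℕ → Set
Least P n = P n × (∀ {m} → m < n → ¬ P m)

least-witness : {P : ℕ → Set} → Decidable P → ∀ {n} → P n → ∃ (Least P)
least-witness {P} P? {n} Pn with search (suc n)
  where
  search : ∀ n → (∀ {m} → m < n → ¬ P m) ⊎ ∃ (Least P)
  search zero = inj₁ λ ()
  search (suc n) with search n
  ... | inj₂ least = inj₂ least
  ... | inj₁ none with P? n
  ...   | yes Pn = inj₂ (n , Pn , none)
  ...   | no ¬Pn = inj₁ λ m<1+n → [ none , (λ { refl → ¬Pn }) ]′ (ℕ.m<1+n⇒m<n∨m≡n m<1+n)
... | inj₁ none  = contradiction Pn (none (ℕ.n<1+n n))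
... | inj₂ least = least

<⇒≡+suc : ∀ {m n} → m < n → ∃ λ d → n ≡ m ℕ.+ suc d
<⇒≡+suc {m} m<n with d , eq ← ℕ.m≤n⇒∃[o]m+o≡n m<n = d , sym (trans (ℕ.+-suc m d) eq)

module FiniteFieldTheory {p m : ℕ} (𝔽 : FiniteField p m) where
  open FiniteField 𝔽
  open IsCommutativeRing isCommutativeRing using
    (+-assoc; +-identityˡ; +-identityʳ; *-assoc; *-comm; *-identityˡ; *-identityʳ; zeroˡ; zeroʳ; -‿inverseˡ)

  ring : CommutativeRing 0ℓ 0ℓ
  ring = record { isCommutativeRing = isCommutativeRing }

  open import Algebra.Properties.Ring (CommutativeRing.ring ring)
    using (x+x≈x⇒x≈0; x[y-z]≈xy-xz; x∙y⁻¹≈ε⇒x≈y; x≈y⇒x∙y⁻¹≈ε)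
  open import Algebra.Properties.Semiring.Exp (CommutativeRing.semiring ring)
    using (_^_; ^-homo-*; ^-assocʳ)
  open import Algebra.Solver.Ring.NaturalCoefficients.Default (CommutativeRing.commutativeSemiring ring)
    using (solve; _:=_; _:+_; _:*_; con)

  open Inverse card using () renaming (to to enum; from to index; strictlyInverseˡ to enum-index)

  index-injective : Injective _≡_ _≡_ index
  index-injective = Injection.injective (↔⇒↣ (↔-sym card))

  infix 4 _≟_
  _≟_ : DecidableEquality Carrier
  x ≟ y = map′ index-injective (cong index) (index x Fin.≟ index y)

  ∀-enum : {P : Carrier → Set} → (∀ i → P (enum i)) → ∀ x → P x
  ∀-enum {P} h x = subst P (enum-index x) (h (index x))

  all? : {P : Carrier → Set} → Decidable P → Dec (∀ x → P x)
  all? P? = map′ ∀-enum (λ h i → h (enum i)) (Fin.all? (P? ∘ enum))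

  ¬∀⇒∃¬ : {P : Carrier → Set} → Decidable P → ¬ (∀ x → P x) → ∃ λ x → ¬ P x
  ¬∀⇒∃¬ {P} P? ¬∀ with i , ¬Pi ← Fin.¬∀⟶∃¬ _ (P ∘ enum) (P? ∘ enum) (¬∀ ∘ ∀-enum) = enum i , ¬Pi

  pigeonhole : (g : ℕ → Carrier) → ∃₂ λ i d → g i ≡ g (i ℕ.+ suc d)
  pigeonhole g with i , j , i<j , gi≡gj ← Fin.pigeonhole (ℕ.n<1+n _) (index ∘ g ∘ toℕ) =
    let d , j≡i+1+d = <⇒≡+suc i<j in toℕ i , d , trans (index-injective gi≡gj) (cong g j≡i+1+d)

  x-y+y≡x : ∀ x y → x - y + y ≡ x
  x-y+y≡x x y = trans (+-assoc x (- y) y) (trans (cong (x +_) (-‿inverseˡ y)) (+-identityʳ x))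

  x*y≡0⇒y≡0 : ∀ {x y} → x ≢ 0# → x * y ≡ 0# → y ≡ 0#
  x*y≡0⇒y≡0 {x} {y} x≢0 xy≡0 with x⁻¹ , xx⁻¹≡1 ← inverse x x≢0 = begin
      y                ≡⟨ *-identityˡ y ⟨
      1# * y           ≡⟨ cong (_* y) xx⁻¹≡1 ⟨
      x * x⁻¹ * y      ≡⟨ cong (_* y) (*-comm x x⁻¹) ⟩
      x⁻¹ * x * y      ≡⟨ *-assoc x⁻¹ x y ⟩
      x⁻¹ * (x * y)    ≡⟨ cong (x⁻¹ *_) xy≡0 ⟩
      x⁻¹ * 0#         ≡⟨ zeroʳ x⁻¹ ⟩
      0#               ∎
    where open ≡-Reasoning

  *-cancelˡ : ∀ {x y z} → x ≢ 0# → x * y ≡ x * z → y ≡ z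
  *-cancelˡ {x} {y} {z} x≢0 eq =
    x∙y⁻¹≈ε⇒x≈y y z (x*y≡0⇒y≡0 x≢0 (trans (x[y-z]≈xy-xz x y z) (x≈y⇒x∙y⁻¹≈ε eq)))

  ^≢0 : ∀ {x} → x ≢ 0# → ∀ n → x ^ n ≢ 0#
  ^≢0 x≢0 zero    = 0≢1 ∘ sym
  ^≢0 x≢0 (suc n) = ^≢0 x≢0 n ∘ x*y≡0⇒y≡0 x≢0

  1^n≡1 : ∀ n → 1# ^ n ≡ 1#
  1^n≡1 zero    = refl
  1^n≡1 (suc n) = trans (*-identityˡ _) (1^n≡1 n)

  ^-^-comm : ∀ x i j → (x ^ i) ^ j ≡ (x ^ j) ^ i
  ^-^-comm x i j = trans (^-assocʳ x i j) (trans (cong (x ^_) (ℕ.*-comm i j)) (sym (^-assocʳ x j i)))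

  ^-cycle : ∀ {x} → x ≢ 0# → ∀ i d → x ^ i ≡ x ^ (i ℕ.+ suc d) → x ^ suc d ≡ 1#
  ^-cycle {x} x≢0 i d eq =
    sym (*-cancelˡ (^≢0 x≢0 i) (trans (*-identityʳ _) (trans eq (^-homo-* x i (suc d)))))

  -- c₀ ∷ ⋯ ∷ cₙ₋₁ ∷ [] encodes the monic polynomial c₀ + c₁ t + ⋯ + cₙ₋₁ tⁿ⁻¹ + tⁿ.
  Monic : Set
  Monic = List Carrier

  ⟦_⟧ : Monic → Carrier → Carrier
  ⟦ []     ⟧ t = 1#
  ⟦ c ∷ cs ⟧ t = c + t * ⟦ cs ⟧ t

  quotient : Carrier → Monic → Monic
  quotient a []               = []
  quotient a (_ ∷ [])         = []
  quotient a (_ ∷ cs@(_ ∷ _)) = ⟦ cs ⟧ a ∷ quotient a cs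

  length-quotient : ∀ a c cs → length (quotient a (c ∷ cs)) ≡ length cs
  length-quotient a c []        = refl
  length-quotient a c (c′ ∷ cs) = cong suc (length-quotient a c′ cs)

  -- Writing t as (t - a) + a turns the ring identities below into semiring identities.
  ⟦⟧-quotient : ∀ a c cs t → ⟦ c ∷ cs ⟧ t ≡ (t - a) * ⟦ quotient a (c ∷ cs) ⟧ t + ⟦ c ∷ cs ⟧ a
  ⟦⟧-quotient a c [] t = begin
      c + t * 1#                     ≡⟨ cong (λ s → c + s * 1#) (x-y+y≡x t a) ⟨
      c + (t - a + a) * 1#           ≡⟨ solve 4 (λ c u a o → c :+ (u :+ a) :* o := u :* o :+ (c :+ a :* o))
                                              refl c (t - a) a 1# ⟩
      (t - a) * 1# + (c + a * 1#)    ∎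
    where open ≡-Reasoning
  ⟦⟧-quotient a c (c′ ∷ cs) t = begin
      c + t * ⟦ c′ ∷ cs ⟧ t                   ≡⟨ cong (λ s → c + t * s) (⟦⟧-quotient a c′ cs t) ⟩
      c + t * ((t - a) * Q + r)               ≡⟨ cong (λ s → c + s * ((t - a) * Q + r)) (x-y+y≡x t a) ⟨
      c + (t - a + a) * ((t - a) * Q + r)     ≡⟨ solve 5 (λ c u a Q r → c :+ (u :+ a) :* (u :* Q :+ r)
                                                          := u :* (r :+ (u :+ a) :* Q) :+ (c :+ a :* r))
                                                       refl c (t - a) a Q r ⟩
      (t - a) * (r + (t - a + a) * Q) + (c + a * r)
                                              ≡⟨ cong (λ s → (t - a) * (r + s * Q) + (c + a * r)) (x-y+y≡x t a) ⟩
      (t - a) * (r + t * Q) + (c + a * r)     ∎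
    where
    open ≡-Reasoning
    Q = ⟦ quotient a (c′ ∷ cs) ⟧ t
    r = ⟦ c′ ∷ cs ⟧ a

  roots≤degree : ∀ {n} (f : Monic) (r : Fin n → Carrier) → Injective _≡_ _≡_ r →
                 (∀ i → ⟦ f ⟧ (r i) ≡ 0#) → n ≤ length f
  roots≤degree {zero}  f        r r-injective root = z≤n
  roots≤degree {suc n} []       r r-injective root = contradiction (sym (root zero)) 0≢1
  roots≤degree {suc n} (c ∷ cs) r r-injective root =
    s≤s (subst (n ≤_) (length-quotient a c cs)
      (roots≤degree (quotient a (c ∷ cs)) (r ∘ suc) (Fin.suc-injective ∘ r-injective) root′))
    where
    a = r zero
    root′ : ∀ i → ⟦ quotient a (c ∷ cs) ⟧ (r (suc i)) ≡ 0#
    root′ i = x*y≡0⇒y≡0 t-a≢0 (begin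
        (t - a) * Q                   ≡⟨ +-identityʳ _ ⟨
        (t - a) * Q + 0#              ≡⟨ cong ((t - a) * Q +_) (root zero) ⟨
        (t - a) * Q + ⟦ c ∷ cs ⟧ a    ≡⟨ ⟦⟧-quotient a c cs t ⟨
        ⟦ c ∷ cs ⟧ t                  ≡⟨ root (suc i) ⟩
        0#                            ∎)
      where
      open ≡-Reasoning
      t = r (suc i)
      Q = ⟦ quotient a (c ∷ cs) ⟧ t
      t-a≢0 : t - a ≢ 0#
      t-a≢0 t-a≡0 with () ← r-injective (x∙y⁻¹≈ε⇒x≈y t a t-a≡0)

  unity-poly : ℕ → Monic
  unity-poly k = - 1# ∷ replicate k 0#

  ⟦unity-poly⟧ : ∀ {t} k → t ^ suc k ≡ 1# → ⟦ unity-poly k ⟧ t ≡ 0#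
  ⟦unity-poly⟧ {t} k tᵏ⁺¹≡1 =
    trans (cong (λ s → - 1# + t * s) (⟦replicate⟧ k)) (trans (cong (- 1# +_) tᵏ⁺¹≡1) (-‿inverseˡ 1#))
    where
    ⟦replicate⟧ : ∀ k → ⟦ replicate k 0# ⟧ t ≡ t ^ k
    ⟦replicate⟧ zero    = refl
    ⟦replicate⟧ (suc k) = trans (+-identityˡ _) (cong (t *_) (⟦replicate⟧ k))

  fun-0# : ∀ (σ : Aut 𝔽) → fun σ 0# ≡ 0#
  fun-0# σ = x+x≈x⇒x≈0 _ (trans (sym (pres-+ σ 0# 0#)) (cong (fun σ) (+-identityʳ 0#)))

  fun-^ : ∀ (σ : Aut 𝔽) x n → fun σ (x ^ n) ≡ fun σ x ^ n
  fun-^ σ x zero    = pres-1 σ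
  fun-^ σ x (suc n) = trans (pres-* σ x _) (cong (fun σ x *_) (fun-^ σ x n))

  fun-injective : ∀ (σ : Aut 𝔽) → Injective _≡_ _≡_ (fun σ)
  fun-injective σ eq = Injection.injective (↔⇒↣ (bijective σ)) (trans (fun≗ σ _) (trans eq (sym (fun≗ σ _))))

  -- x has multiplicative order 1 + k.
  MulOrder : Carrier → ℕ → Set
  MulOrder x k = Least (λ j → x ^ suc j ≡ 1#) k

  mulOrder : ∀ {x} → x ≢ 0# → ∃ (MulOrder x)
  mulOrder {x} x≢0 with i , d , eq ← pigeonhole (x ^_) =
    least-witness (λ j → x ^ suc j ≟ 1#) {d} (^-cycle x≢0 i d eq)

  module _ {x k} (ord : MulOrder x k) where
    private
      xᵏ⁺¹≡1 = proj₁ ord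
      minimal = proj₂ ord

    MulOrder⇒≢0 : x ≢ 0#
    MulOrder⇒≢0 refl = 0≢1 (trans (sym (zeroˡ _)) xᵏ⁺¹≡1)

    ^-distinct : ∀ {i j} → i < j → j ≤ k → x ^ i ≢ x ^ j
    ^-distinct {i} i<j j≤k eq with d , refl ← <⇒≡+suc i<j =
      minimal (ℕ.≤-trans (ℕ.m≤n+m (suc d) i) j≤k) (^-cycle MulOrder⇒≢0 i d eq)

    ^-injective : ∀ {i j} → i ≤ k → j ≤ k → x ^ i ≡ x ^ j → i ≡ j
    ^-injective {i} {j} i≤k j≤k xⁱ≡xʲ with ℕ.<-cmp i j
    ... | tri≈ _ i≡j _ = i≡j
    ... | tri< i<j _ _ = contradiction xⁱ≡xʲ (^-distinct i<j j≤k)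
    ... | tri> _ _ j<i = contradiction (sym xⁱ≡xʲ) (^-distinct j<i i≤k)

    -- The powers 1, x, …, xᵏ are k + 1 distinct roots of tᵏ⁺¹ − 1, so they are all of them.
    root⇒power : ∀ {y} → y ^ suc k ≡ 1# → ∃ λ i → y ≡ x ^ i
    root⇒power {y} yᵏ⁺¹≡1 with Fin.any? (λ (i : Fin (suc k)) → y ≟ x ^ toℕ i)
    ... | yes (i , y≡xⁱ) = toℕ i , y≡xⁱ
    ... | no y∉powers = contradiction
          (subst (suc (suc k) ≤_) (cong suc (length-replicate k)) (roots≤degree (unity-poly k) r r-injective r-root))
          ℕ.1+n≰n
      where
      r : Fin (suc (suc k)) → Carrier
      r zero    = y
      r (suc i) = x ^ toℕ i
      r-injective : Injective _≡_ _≡_ r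
      r-injective {zero}  {zero}  _  = refl
      r-injective {zero}  {suc j} eq = contradiction (j , eq) y∉powers
      r-injective {suc i} {zero}  eq = contradiction (i , sym eq) y∉powers
      r-injective {suc i} {suc j} eq =
        cong suc (Fin.toℕ-injective (^-injective (Fin.toℕ≤pred[n] i) (Fin.toℕ≤pred[n] j) eq))
      r-root : ∀ i → ⟦ unity-poly k ⟧ (r i) ≡ 0#
      r-root zero    = ⟦unity-poly⟧ k yᵏ⁺¹≡1
      r-root (suc i) = ⟦unity-poly⟧ k
        (trans (^-^-comm x (toℕ i) (suc k)) (trans (cong (_^ toℕ i) xᵏ⁺¹≡1) (1^n≡1 (toℕ i))))

    fun-root : ∀ (ρ : Aut 𝔽) → fun ρ x ^ suc k ≡ 1#
    fun-root ρ = trans (sym (fun-^ ρ x (suc k))) (trans (cong (fun ρ) xᵏ⁺¹≡1) (pres-1 ρ))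

    MulOrder⇒fun-comm : ∀ (σ τ : Aut 𝔽) → fun σ (fun τ x) ≡ fun τ (fun σ x)
    MulOrder⇒fun-comm σ τ with i , σx≡xⁱ ← root⇒power (fun-root σ)
                               | j , τx≡xʲ ← root⇒power (fun-root τ) = begin
        fun σ (fun τ x)    ≡⟨ cong (fun σ) τx≡xʲ ⟩
        fun σ (x ^ j)      ≡⟨ fun-^ σ x j ⟩
        fun σ x ^ j        ≡⟨ cong (_^ j) σx≡xⁱ ⟩
        (x ^ i) ^ j        ≡⟨ ^-^-comm x i j ⟩
        (x ^ j) ^ i        ≡⟨ cong (_^ i) τx≡xʲ ⟨
        fun τ x ^ i        ≡⟨ fun-^ τ x i ⟨
        fun τ (x ^ i)      ≡⟨ cong (fun τ) σx≡xⁱ ⟨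
        fun τ (fun σ x)    ∎
      where open ≡-Reasoning

  fun⁻¹ : Aut 𝔽 → Carrier → Carrier
  fun⁻¹ σ = Inverse.from (bijective σ)

  fun-fun⁻¹ : ∀ (σ : Aut 𝔽) y → fun σ (fun⁻¹ σ y) ≡ y
  fun-fun⁻¹ σ y = trans (sym (fun≗ σ _)) (Inverse.strictlyInverseˡ (bijective σ) y)

  fun-comm : ∀ (σ τ : Aut 𝔽) x → fun σ (fun τ x) ≡ fun τ (fun σ x)
  fun-comm σ τ x with x ≟ 0#
  ... | yes refl = trans (fun∘fun-0# σ τ) (sym (fun∘fun-0# τ σ))
    where
    fun∘fun-0# : ∀ (σ τ : Aut 𝔽) → fun σ (fun τ 0#) ≡ 0#
    fun∘fun-0# σ τ = trans (cong (fun σ) (fun-0# τ)) (fun-0# σ)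
  ... | no x≢0   = MulOrder⇒fun-comm (proj₂ (mulOrder x≢0)) σ τ

  pow-+ : ∀ σ a b x → pow 𝔽 σ (a ℕ.+ b) x ≡ pow 𝔽 σ a (pow 𝔽 σ b x)
  pow-+ σ zero    b x = refl
  pow-+ σ (suc a) b x = cong (fun σ) (pow-+ σ a b x)

  pow-injective : ∀ σ n → Injective _≡_ _≡_ (pow 𝔽 σ n)
  pow-injective σ zero    eq = eq
  pow-injective σ (suc n) eq = pow-injective σ n (fun-injective σ eq)

  fun-pow-comm : ∀ σ τ n x → fun σ (pow 𝔽 τ n x) ≡ pow 𝔽 τ n (fun σ x)
  fun-pow-comm σ τ zero    x = refl
  fun-pow-comm σ τ (suc n) x = trans (fun-comm σ τ _) (cong (fun τ) (fun-pow-comm σ τ n x))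

  pow-∘ : ∀ {h α β} → (∀ x → fun h x ≡ fun α (fun β x)) →
          ∀ n x → pow 𝔽 h n x ≡ pow 𝔽 α n (pow 𝔽 β n x)
  pow-∘ h≗αβ zero    x = refl
  pow-∘ {h} {α} {β} h≗αβ (suc n) x = begin
      fun h (pow 𝔽 h n x)                         ≡⟨ h≗αβ _ ⟩
      fun α (fun β (pow 𝔽 h n x))                 ≡⟨ cong (fun α ∘ fun β) (pow-∘ h≗αβ n x) ⟩
      fun α (fun β (pow 𝔽 α n (pow 𝔽 β n x)))     ≡⟨ cong (fun α) (fun-pow-comm β α n _) ⟩
      fun α (pow 𝔽 α n (fun β (pow 𝔽 β n x)))     ∎
    where open ≡-Reasoning

  pow-∣ : ∀ σ n {k x} → n ∣ k → pow 𝔽 σ n x ≡ x → pow 𝔽 σ k x ≡ x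
  pow-∣ σ n {x = x} (divides q refl) σⁿx≡x = pow-multiple q
    where
    pow-multiple : ∀ q → pow 𝔽 σ (q ℕ.* n) x ≡ x
    pow-multiple zero    = refl
    pow-multiple (suc q) = trans (pow-+ σ n (q ℕ.* n) x) (trans (cong (pow 𝔽 σ n) (pow-multiple q)) σⁿx≡x)

  pow-period : ∀ σ x → ∃ λ d → pow 𝔽 σ (suc d) x ≡ x
  pow-period σ x with i , d , eq ← pigeonhole (λ n → pow 𝔽 σ n x) =
    d , sym (pow-injective σ i (trans eq (pow-+ σ i (suc d) x)))

  common-period : ∀ σ n (xs : Fin n → Carrier) → ∃ λ K → ∀ i → pow 𝔽 σ (suc K) (xs i) ≡ xs i
  common-period σ zero    xs = 0 , λ ()
  common-period σ (suc n) xs with d , fixes-x₀ ← pow-period σ (xs zero)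
                                | K , fixes-xs ← common-period σ n (xs ∘ suc) =
    K ℕ.+ d ℕ.* suc K , λ where
      zero    → pow-∣ σ (suc d) (m∣m*n (suc K)) fixes-x₀
      (suc i) → pow-∣ σ (suc K) (n∣m*n (suc d)) (fixes-xs i)

  PowTrivial? : ∀ σ n → Dec (PowTrivial 𝔽 σ n)
  PowTrivial? σ n = all? (λ x → pow 𝔽 σ n x ≟ x)

  order : ∀ σ → ∃ (HasOrder 𝔽 σ)
  order σ =
    let K , fixes = common-period σ _ enum
        k , σᵏ⁺¹≡id , minimal = least-witness (PowTrivial? σ ∘ suc) {K} (∀-enum fixes)
    in suc k , s≤s z≤n , σᵏ⁺¹≡id , λ where
      zero    ()
      (suc j) _ σʲ⁺¹≡id → s≤s (ℕ.≮⇒≥ (λ j<k → minimal j<k σʲ⁺¹≡id))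

  HasOrder⇒¬IsTrivial : ∀ {σ n} → HasOrder 𝔽 σ n → 1 < n → ¬ IsTrivial 𝔽 σ
  HasOrder⇒¬IsTrivial (_ , _ , minimal) 1<n σ≗id = ℕ.<⇒≱ 1<n (minimal 1 (s≤s z≤n) σ≗id)

  HasExponent⇒¬AllTrivial : ∀ {I} {f : I → Aut 𝔽} {n} → HasExponent 𝔽 f n → 1 < n →
                            ¬ (∀ i → IsTrivial 𝔽 (f i))
  HasExponent⇒¬AllTrivial (_ , _ , minimal) 1<n all-id = ℕ.<⇒≱ 1<n (minimal 1 (s≤s z≤n) all-id)

  HasExponent-∘ : ∀ {I J} {g : J → Aut 𝔽} (h : I → J) {n k} →
                  HasExponent 𝔽 (g ∘ h) n → HasExponent 𝔽 g k → n ≤ k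
  HasExponent-∘ h (_ , _ , minimal) (0<k , g-trivial , _) = minimal _ 0<k (g-trivial ∘ h)

  HasMaxOrder-1⇒IsTrivial : ∀ {I} {f : I → Aut 𝔽} → HasMaxOrder 𝔽 f 1 → ∀ i → IsTrivial 𝔽 (f i)
  HasMaxOrder-1⇒IsTrivial {f = f} (_ , orders≤1) i with k , ord@(0<k , σᵏ≗id , _) ← order (f i) =
    subst (PowTrivial 𝔽 (f i)) (ℕ.≤-antisym (orders≤1 i k ord) 0<k) σᵏ≗id

module SemilinearGroup {p m : ℕ} (𝔽 : FiniteField p m)
                       (T : FiniteField.Carrier 𝔽 → FiniteField.Carrier 𝔽 → FiniteField.Carrier 𝔽 → FiniteField.Carrier 𝔽)
                       (θ : FiniteField.Carrier 𝔽 → FiniteField.Carrier 𝔽 → FiniteField.Carrier 𝔽 → Aut 𝔽)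
                       (closed : Closed 𝔽 T θ) where
  open FiniteField 𝔽
  open FiniteFieldTheory 𝔽
  open import Algebra.Solver.Ring.NaturalCoefficients.Default (CommutativeRing.commutativeSemiring ring)
    using (solve; _:=_; _:+_; _:*_; con)

  θ-cong : ∀ {a b c a′ b′ c′} → a ≡ a′ → b ≡ b′ → c ≡ c′ → ∀ x → fun (θ a b c) x ≡ fun (θ a′ b′ c′) x
  θ-cong refl refl refl x = refl

  -- The parameters of a product in G are the first three entries of the bottom row of its matrix.
  θ-∘ : ∀ a b c a′ b′ c′ x → let σ = θ a′ b′ c′ ; t′ = T a′ b′ c′ in
        fun (θ a b c) (fun σ x) ≡
        fun (θ (fun σ a * 1# + fun σ b * - c′ + fun σ c * (b′ - c′ * t′) + fun σ 1# * a′)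
               (fun σ a * 0# + fun σ b * 1# + fun σ c * t′ + fun σ 1# * b′)
               (fun σ a * 0# + fun σ b * 0# + fun σ c * 1# + fun σ 1# * c′)) x
  θ-∘ a b c a′ b′ c′ x with _ , _ , _ , E-eq , θ-eq ← closed a b c a′ b′ c′ =
    trans (θ-eq x) (θ-cong (sym (E-eq (# 3) (# 0))) (sym (E-eq (# 3) (# 1))) (sym (E-eq (# 3) (# 2))) x)

  θ-split-ab : ∀ a b x → fun (θ a b 0#) x ≡ fun (θ (fun⁻¹ (θ 0# b 0#) a) 0# 0#) (fun (θ 0# b 0#) x)
  θ-split-ab a b x =
    let a≡ , b≡ , c≡ = bottom-row (fun-fun⁻¹ β a) (fun-0# β) (pres-1 β)
    in trans (θ-cong (sym a≡) (sym b≡) (sym c≡) x) (sym (θ-∘ (fun⁻¹ β a) 0# 0# 0# b 0# x))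
    where
    β = θ 0# b 0#
    t = T 0# b 0#
    bottom-row : ∀ {u z o} → u ≡ a → z ≡ 0# → o ≡ 1# →
                 (u * 1# + z * - 0# + z * (b - 0# * t) + o * 0# ≡ a)
                 × (u * 0# + z * 1# + z * t + o * b ≡ b)
                 × (u * 0# + z * 0# + z * 1# + o * 0# ≡ 0#)
    bottom-row refl refl refl =
      solve 3 (λ a y w → a :* con 1 :+ con 0 :* y :+ con 0 :* w :+ con 1 :* con 0 := a) refl a (- 0#) (b - 0# * t) ,
      solve 3 (λ a t b → a :* con 0 :+ con 0 :* con 1 :+ con 0 :* t :+ con 1 :* b := b) refl a t b ,
      solve 1 (λ a → a :* con 0 :+ con 0 :* con 0 :+ con 0 :* con 1 :+ con 1 :* con 0 := con 0) refl a

  θ-split-c : ∀ a b c x → fun (θ a b c) x ≡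
              fun (θ (fun⁻¹ (θ 0# 0# c) (a + b * c)) (fun⁻¹ (θ 0# 0# c) b) 0#) (fun (θ 0# 0# c) x)
  θ-split-c a b c x =
    let a≡ , b≡ , c≡ = bottom-row (fun-fun⁻¹ γ (a + b * c)) (fun-fun⁻¹ γ b) (fun-0# γ) (pres-1 γ)
    in trans (θ-cong (sym a≡) (sym b≡) (sym c≡) x)
             (sym (θ-∘ (fun⁻¹ γ (a + b * c)) (fun⁻¹ γ b) 0# 0# 0# c x))
    where
    open IsCommutativeRing isCommutativeRing using (+-identityʳ; zeroʳ; -‿inverseʳ)
    open ≡-Reasoning
    γ = θ 0# 0# c
    t = T 0# 0# c
    bottom-row : ∀ {u v z o} → u ≡ a + b * c → v ≡ b → z ≡ 0# → o ≡ 1# →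
                 (u * 1# + v * - c + z * (0# - c * t) + o * 0# ≡ a)
                 × (u * 0# + v * 1# + z * t + o * 0# ≡ b)
                 × (u * 0# + v * 0# + z * 1# + o * c ≡ c)
    bottom-row refl refl refl refl = (begin
        (a + b * c) * 1# + b * - c + 0# * (0# - c * t) + 1# * 0#
          ≡⟨ solve 5 (λ a b c n w → (a :+ b :* c) :* con 1 :+ b :* n :+ con 0 :* w :+ con 1 :* con 0
                                    := a :+ b :* (c :+ n)) refl a b c (- c) (0# - c * t) ⟩
        a + b * (c - c)   ≡⟨ cong (λ s → a + b * s) (-‿inverseʳ c) ⟩
        a + b * 0#        ≡⟨ cong (a +_) (zeroʳ b) ⟩
        a + 0#            ≡⟨ +-identityʳ a ⟩
        a                 ∎) ,
      solve 3 (λ u b t → u :* con 0 :+ b :* con 1 :+ con 0 :* t :+ con 1 :* con 0 := b) refl (a + b * c) b t ,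
      solve 3 (λ u b c → u :* con 0 :+ b :* con 0 :+ con 0 :* con 1 :+ con 1 :* c := c) refl (a + b * c) b c

open import Data.Nat using (_^_)

^-cancelˡ-≤ : ∀ {m a b} → 1 < m → m ^ a ≤ m ^ b → a ≤ b
^-cancelˡ-≤ {m} 1<m mᵃ≤mᵇ = ℕ.≮⇒≥ (λ b<a → ℕ.<⇒≱ (ℕ.^-monoʳ-< m 1<m b<a) mᵃ≤mᵇ)

^-monoʳ-∣ : ∀ m {a b} → a ≤ b → m ^ a ∣ m ^ b
^-monoʳ-∣ m {a} {b} a≤b = divides (m ^ (b ℕ.∸ a)) (begin
    m ^ b                    ≡⟨ cong (m ^_) (ℕ.m+[n∸m]≡n a≤b) ⟨
    m ^ (a ℕ.+ (b ℕ.∸ a))    ≡⟨ ℕ.^-distribˡ-+-* m a (b ℕ.∸ a) ⟩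
    m ^ a ℕ.* m ^ (b ℕ.∸ a)  ≡⟨ ℕ.*-comm (m ^ a) _ ⟩
    m ^ (b ℕ.∸ a) ℕ.* m ^ a  ∎)
  where open ≡-Reasoning

module Corollary {p m : ℕ} (p-prime : Prime p) (𝔽 : FiniteField p m)
                 (T : FiniteField.Carrier 𝔽 → FiniteField.Carrier 𝔽 → FiniteField.Carrier 𝔽 → FiniteField.Carrier 𝔽)
                 (θ : FiniteField.Carrier 𝔽 → FiniteField.Carrier 𝔽 → FiniteField.Carrier 𝔽 → Aut 𝔽)
                 (closed : Closed 𝔽 T θ) where
  open FiniteField 𝔽
  open FiniteFieldTheory 𝔽
  open SemilinearGroup 𝔽 T θ closed

  instance
    p≢0 : ℕ.NonZero p
    p≢0 = prime⇒nonZero p-prime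

  1<p : 1 < p
  1<p = ℕ.nonTrivial⇒n>1 p {{prime⇒nonTrivial p-prime}}

  1<p^ : ∀ {r} → 0 < r → 1 < p ^ r
  1<p^ = ℕ.^-monoʳ-< p 1<p

  rAB≡rA⊔rB : ∀ rA rB rAB → HasExponent 𝔽 (ψA 𝔽 T θ) (p ^ rA) →
              HasExponent 𝔽 (ψB 𝔽 T θ) (p ^ rB) →
              HasExponent 𝔽 (ψAB 𝔽 T θ) (p ^ rAB) → rAB ≡ rA ⊔ rB
  rAB≡rA⊔rB rA rB rAB eA@(_ , A-trivial , _) eB@(_ , B-trivial , _) eAB@(_ , _ , AB-minimal) =
    ℕ.≤-antisym rAB≤M (ℕ.⊔-lub rA≤rAB rB≤rAB)
    where
    open ≡-Reasoning
    M = rA ⊔ rB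
    rA≤rAB : rA ≤ rAB
    rA≤rAB = ^-cancelˡ-≤ 1<p (HasExponent-∘ (_, 0#) eA eAB)
    rB≤rAB : rB ≤ rAB
    rB≤rAB = ^-cancelˡ-≤ 1<p (HasExponent-∘ (0# ,_) eB eAB)
    AB-trivial : ∀ ab → PowTrivial 𝔽 (ψAB 𝔽 T θ ab) (p ^ M)
    AB-trivial (a , b) x = begin
      pow 𝔽 (θ a b 0#) (p ^ M) x                      ≡⟨ pow-∘ (θ-split-ab a b) (p ^ M) x ⟩
      pow 𝔽 α (p ^ M) (pow 𝔽 β (p ^ M) x)             ≡⟨ cong (pow 𝔽 α (p ^ M))
                                                            (pow-∣ β (p ^ rB) (^-monoʳ-∣ p (ℕ.m≤n⊔m rA rB)) (B-trivial b x)) ⟩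
      pow 𝔽 α (p ^ M) x                               ≡⟨ pow-∣ α (p ^ rA) (^-monoʳ-∣ p (ℕ.m≤m⊔n rA rB)) (A-trivial _ x) ⟩
      x                                               ∎
      where
      β = θ 0# b 0#
      α = θ (fun⁻¹ β a) 0# 0#
    rAB≤M : rAB ≤ M
    rAB≤M = ^-cancelˡ-≤ 1<p (AB-minimal (p ^ M) (ℕ.m^n>0 p M) AB-trivial)

  θ-IsTrivial : HasExponent 𝔽 (ψAB 𝔽 T θ) 1 → HasMaxOrder 𝔽 (σC 𝔽 T θ) 1 →
                ∀ a b c → IsTrivial 𝔽 (θ a b c)
  θ-IsTrivial (_ , AB-trivial , _) mC a b c x =
    trans (θ-split-c a b c x) (trans (AB-trivial _ _) (HasMaxOrder-1⇒IsTrivial mC c x))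

  nontrivial⇒positive : ∀ rAB rC → HasExponent 𝔽 (ψAB 𝔽 T θ) (p ^ rAB) →
                        HasMaxOrder 𝔽 (σC 𝔽 T θ) (p ^ rC) →
                        (∃ λ a → ∃ λ b → ∃ λ c → ¬ IsTrivial 𝔽 (θ a b c)) → 0 < rAB ⊎ 0 < rC
  nontrivial⇒positive (suc _) _       _   _  _ = inj₁ (s≤s z≤n)
  nontrivial⇒positive zero    (suc _) _   _  _ = inj₂ (s≤s z≤n)
  nontrivial⇒positive zero    zero    eAB mC (a , b , c , θ≉id) = contradiction (θ-IsTrivial eAB mC a b c) θ≉id

  positive⇒nontrivial : ∀ {rAB rC} → HasExponent 𝔽 (ψAB 𝔽 T θ) (p ^ rAB) →
                        HasMaxOrder 𝔽 (σC 𝔽 T θ) (p ^ rC) →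
                        0 < rAB ⊎ 0 < rC → ∃ λ a → ∃ λ b → ∃ λ c → ¬ IsTrivial 𝔽 (θ a b c)
  positive⇒nontrivial _ ((c , ord) , _) (inj₂ 0<rC) = 0# , 0# , c , HasOrder⇒¬IsTrivial ord (1<p^ 0<rC)
  positive⇒nontrivial eAB _ (inj₁ 0<rAB) =
    let a , ¬∀b  = ¬∀⇒∃¬ (λ a → all? (λ b → PowTrivial? (θ a b 0#) 1))
                         (λ all-id → HasExponent⇒¬AllTrivial eAB (1<p^ 0<rAB) (λ (a , b) → all-id a b))
        b , θ≉id = ¬∀⇒∃¬ (λ b → PowTrivial? (θ a b 0#) 1) ¬∀b
    in a , b , 0# , θ≉id

corollary2p5 : (p m : ℕ) → Prime p → (𝔽 : FiniteField p m) →
    (T : FiniteField.Carrier 𝔽 → FiniteField.Carrier 𝔽 → FiniteField.Carrier 𝔽 → FiniteField.Carrier 𝔽) →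
    (θ : FiniteField.Carrier 𝔽 → FiniteField.Carrier 𝔽 → FiniteField.Carrier 𝔽 → Aut 𝔽) →
    Closed 𝔽 T θ →
    (rA rB rAB rC : ℕ) →
    HasExponent 𝔽 (ψA 𝔽 T θ) (p ^ rA) →
    HasExponent 𝔽 (ψB 𝔽 T θ) (p ^ rB) →
    HasExponent 𝔽 (ψAB 𝔽 T θ) (p ^ rAB) →
    HasMaxOrder 𝔽 (σC 𝔽 T θ) (p ^ rC) →
    (rAB ≡ rA ⊔ rB)
    × ((∃ λ a → ∃ λ b → ∃ λ c → ¬ IsTrivial 𝔽 (θ a b c)) → (0 < rAB ⊎ 0 < rC))
    × ((0 < rAB ⊎ 0 < rC) → ∃ λ a → ∃ λ b → ∃ λ c → ¬ IsTrivial 𝔽 (θ a b c))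
corollary2p5 p m p-prime 𝔽 T θ closed rA rB rAB rC eA eB eAB mC =
  rAB≡rA⊔rB rA rB rAB eA eB eAB , nontrivial⇒positive rAB rC eAB mC , positive⇒nontrivial eAB mC
  where open Corollary p-prime 𝔽 T θ closed
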